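{- For every integer $n$, \[ \sum_{k = (1 + (-1)^n)/2}^n (-1)^{k - 1} L_k^{\,4} = (-1)^{n - 1} \frac{5}{3}F_n F_{n + 1} \left(L_{n - 2} L_{n + 3} + 2(-1)^n\right). \] Thus the sum starts at $k=1$ when $n$ is even and at $k=0$ when $n$ is odd.
   Context: $F_n$ and $L_n$ ($n\in\mathbb{Z}$) are the Fibonacci and Lucas numbers: $F_n=F_{n-1}+F_{n-2}$ with $F_0=0$, $F_1=1$; $L_n=L_{n-1}+L_{n-2}$ with $L_0=2$, $L_1=1$; extended to negative indices by $F_{ -n}=(-1)^{n-1}F_n$, $L_{ -n}=(-1)^nL_n$. -}

module Defs where

open import Data.Nat as ℕ using (ℕ; zero; suc)
open import Data.Integer as ℤ using (ℤ; +_; -[1+_]; _+_; _-_; _*_; -_; 0ℤ; 1ℤ; ∣_∣)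

fibℕ : ℕ → ℕ
fibℕ zero = 0
fibℕ (suc zero) = 1
fibℕ (suc (suc n)) = fibℕ (suc n) ℕ.+ fibℕ n

lucℕ : ℕ → ℕ
lucℕ zero = 2
lucℕ (suc zero) = 1
lucℕ (suc (suc n)) = lucℕ (suc n) ℕ.+ lucℕ n

sgnℕ : ℕ → ℤ
sgnℕ zero = 1ℤ
sgnℕ (suc m) = - sgnℕ m

-- (-1)^n for n : ℤ  (depends only on the parity of n)
neg1^ : ℤ → ℤ
neg1^ n = sgnℕ ∣ n ∣

-- F_n, L_n for n : ℤ, with F_{-m} = (-1)^{m-1} F_m, L_{-m} = (-1)^m L_m
F : ℤ → ℤ
F (+ n) = + fibℕ n
F -[1+ n ] = sgnℕ n * + fibℕ (suc n)

L : ℤ → ℤ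
L (+ n) = + lucℕ n
L -[1+ n ] = sgnℕ (suc n) * + lucℕ (suc n)

-- (1 + (-1)^n)/2 : equals 1 for even n, 0 for odd n
startℕ : ℕ → ℤ
startℕ zero = 1ℤ
startℕ (suc zero) = 0ℤ
startℕ (suc (suc m)) = startℕ m

startIndex : ℤ → ℤ
startIndex n = startℕ ∣ n ∣

sumFrom : (ℤ → ℤ) → ℤ → ℕ → ℤ
sumFrom f a zero = 0ℤ
sumFrom f a (suc m) = f a + sumFrom f (a + 1ℤ) m

-- Σ_{k=a}^{b} f k, with the standard convention for b < a:
--   Σ_{k=a}^{b} = 0 if b = a - 1, and Σ_{k=a}^{b} = - Σ_{k=b+1}^{a-1} if b < a - 1.
Σ[_⋯_] : ℤ → ℤ → (ℤ → ℤ) → ℤ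
Σ[ a ⋯ b ] f with b - a + 1ℤ
... | + m = sumFrom f a m
... | -[1+ m ] = - sumFrom f (b + 1ℤ) (suc m)

{-# OPTIONS --safe #-}

-- Write S n for the left-hand sum and R n for the right-hand side.  The lower limit
-- depends only on the parity of n, so S (n + 2) = S n + f (n + 1) + f (n + 2), where f is
-- the summand.  Via the addition formula L (n + k) = L (k - 1) F n + L k F (n + 1) and
-- Cassini's identity (-1)^n = F (n+1)^2 - F (n+1) F n - F n ^2, both R n and f n are
-- polynomials in F n and F (n + 1), and R (n + 2) = R n + 3 (f (n + 1) + f (n + 2)) becomes
-- a polynomial identity.  So 3 S n - R n is 2-periodic; it vanishes at 0 and 1, hence
-- everywhere (the step is invertible, so the induction runs in both directions over ℤ).
module Submission where

open import Algebra.Bundles using (AbelianGroup)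
open import Data.Integer using (ℤ; +_; -[1+_]; _+_; _-_; _*_; _^_; -_; 0ℤ; 1ℤ; -1ℤ; suc; pred)
open import Data.Integer.Properties
  using (+-0-abelianGroup; *-distribˡ-+; +-assoc; +-comm; +-identityˡ; +-identityʳ;
         neg-involutive; suc-pred)
open import Data.Integer.Tactic.RingSolver using (solve-∀)
import Data.Nat as ℕ
open import Data.Product using (_×_; _,_; proj₁)
open import Function.Base using (_∘_)
open import Function.Bundles using (_⇔_; mk⇔; Equivalence)
open import Relation.Binary.PropositionalEquality

open import Algebra.Properties.Group (AbelianGroup.group +-0-abelianGroup)
  using (∙-cancelˡ; ∙-cancelʳ)
open import Defs

open ≡-Reasoning
open Equivalence using (to; from)

ℤ-induction : (P : ℤ → Set) → (∀ n → P n ⇔ P (suc n)) → P 0ℤ → ∀ n → P n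
ℤ-induction P step base (+ ℕ.zero)      = base
ℤ-induction P step base (+ ℕ.suc m)     = to (step (+ m)) (ℤ-induction P step base (+ m))
ℤ-induction P step base -[1+ ℕ.zero ]  = from (step -[1+ 0 ]) base
ℤ-induction P step base -[1+ ℕ.suc m ] = from (step -[1+ ℕ.suc m ]) (ℤ-induction P step base -[1+ m ])

ℤ-induction₂ : (P : ℤ → Set) → (∀ n → P n ⇔ P (suc (suc n))) → P 0ℤ → P 1ℤ → ∀ n → P n
ℤ-induction₂ P step p₀ p₁ n = proj₁ (ℤ-induction (λ n → P n × P (suc n)) pair-step (p₀ , p₁) n)
  where
  pair-step : ∀ n → (P n × P (suc n)) ⇔ (P (suc n) × P (suc (suc n)))
  pair-step n = mk⇔ (λ (p , q) → q , to (step n) p) (λ (q , r) → from (step n) r , q)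

IsFibonacciLike : (ℤ → ℤ) → Set
IsFibonacciLike X = ∀ n → X (suc (suc n)) ≡ X (suc n) + X n

IsAlternating : (ℤ → ℤ) → Set
IsAlternating X = ∀ n → X (suc n) ≡ - X n

fibonacciLike-unique : ∀ {X Y} → IsFibonacciLike X → IsFibonacciLike Y →
                       X 0ℤ ≡ Y 0ℤ → X 1ℤ ≡ Y 1ℤ → ∀ n → X n ≡ Y n
fibonacciLike-unique {X} {Y} recX recY e₀ e₁ n = proj₁ (ℤ-induction Agree step (e₀ , e₁) n)
  where
  Agree : ℤ → Set
  Agree n = X n ≡ Y n × X (suc n) ≡ Y (suc n)
  step : ∀ n → Agree n ⇔ Agree (suc n)
  step n = mk⇔
    (λ (p , q) → q , trans (recX n) (trans (cong₂ _+_ q p) (sym (recY n))))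
    (λ (q , r) → ∙-cancelˡ (Y (suc n)) (X n) (Y n)
                   (trans (cong (_+ X n) (sym q)) (trans (sym (recX n)) (trans r (recY n)))) , q)

alternating-unique : ∀ {X Y} → IsAlternating X → IsAlternating Y → X 0ℤ ≡ Y 0ℤ →
                     ∀ n → X n ≡ Y n
alternating-unique {X} {Y} altX altY = ℤ-induction (λ n → X n ≡ Y n) step
  where
  step : ∀ n → X n ≡ Y n ⇔ X (suc n) ≡ Y (suc n)
  step n = mk⇔
    (λ p → trans (altX n) (trans (cong -_ p) (sym (altY n))))
    (λ q → begin
      X n       ≡⟨ neg-involutive (X n) ⟨
      - - X n   ≡⟨ cong -_ (trans (sym (altX n)) (trans q (altY n))) ⟩
      - - Y n   ≡⟨ neg-involutive (Y n) ⟩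
      Y n       ∎)

shift-isFibonacciLike : ∀ {X} → IsFibonacciLike X → ∀ k → IsFibonacciLike (λ n → X (n + k))
shift-isFibonacciLike {X} recX k n = begin
  X (suc (suc n) + k)           ≡⟨ cong X (suc-suc-+ n k) ⟩
  X (suc (suc (n + k)))         ≡⟨ recX (n + k) ⟩
  X (suc (n + k)) + X (n + k)   ≡⟨ cong (λ i → X i + X (n + k)) (suc-+ n k) ⟨
  X (suc n + k) + X (n + k)     ∎
  where
  suc-suc-+ : ∀ m k → 1ℤ + (1ℤ + m) + k ≡ 1ℤ + (1ℤ + (m + k))
  suc-suc-+ = solve-∀
  suc-+ : ∀ m k → 1ℤ + m + k ≡ 1ℤ + (m + k)
  suc-+ = solve-∀

combination-isFibonacciLike : ∀ {X Y} → IsFibonacciLike X → IsFibonacciLike Y →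
                              ∀ c d → IsFibonacciLike (λ n → c * X n + d * Y n)
combination-isFibonacciLike {X} {Y} recX recY c d n
  rewrite recX n | recY n = distribute c d (X (suc n)) (X n) (Y (suc n)) (Y n)
  where
  distribute : ∀ c d x₁ x₀ y₁ y₀ →
               c * (x₁ + x₀) + d * (y₁ + y₀) ≡ (c * x₁ + d * y₁) + (c * x₀ + d * y₀)
  distribute = solve-∀

alternating-recurrence : ∀ s x y → s * x ≡ (- s) * y + (- - s) * (y + x)
alternating-recurrence = solve-∀

F-isFibonacciLike : IsFibonacciLike F
F-isFibonacciLike (+ m)                    = refl
F-isFibonacciLike -[1+ 0 ]                 = refl
F-isFibonacciLike -[1+ 1 ]                 = refl
F-isFibonacciLike -[1+ ℕ.suc (ℕ.suc m) ] =
  alternating-recurrence (sgnℕ m) (+ fibℕ (ℕ.suc m)) (+ fibℕ (ℕ.suc (ℕ.suc m)))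

L-isFibonacciLike : IsFibonacciLike L
L-isFibonacciLike (+ m)                    = refl
L-isFibonacciLike -[1+ 0 ]                 = refl
L-isFibonacciLike -[1+ 1 ]                 = refl
L-isFibonacciLike -[1+ ℕ.suc (ℕ.suc m) ] =
  alternating-recurrence (sgnℕ (ℕ.suc m)) (+ lucℕ (ℕ.suc m)) (+ lucℕ (ℕ.suc (ℕ.suc m)))

neg1^-isAlternating : IsAlternating neg1^
neg1^-isAlternating (+ m)           = refl
neg1^-isAlternating -[1+ 0 ]        = refl
neg1^-isAlternating -[1+ ℕ.suc m ] = sym (neg-involutive (sgnℕ (ℕ.suc m)))

neg1^-pred : ∀ n → neg1^ (n - + 1) ≡ - neg1^ n
neg1^-pred n = begin
  neg1^ (n - + 1)          ≡⟨ cong neg1^ (+-comm n -1ℤ) ⟩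
  neg1^ (pred n)           ≡⟨ neg-involutive _ ⟨
  - - neg1^ (pred n)       ≡⟨ cong -_ (neg1^-isAlternating (pred n)) ⟨
  - neg1^ (suc (pred n))   ≡⟨ cong (λ i → - neg1^ i) (suc-pred n) ⟩
  - neg1^ n                ∎

cassiniForm : ℤ → ℤ → ℤ
cassiniForm a b = b * b - b * a - a * a

neg1^≡cassiniForm : ∀ n → neg1^ n ≡ cassiniForm (F n) (F (suc n))
neg1^≡cassiniForm = alternating-unique neg1^-isAlternating cassini-isAlternating refl
  where
  cassiniForm-step : ∀ a b → (b + a) * (b + a) - (b + a) * b - b * b ≡ - (b * b - b * a - a * a)
  cassiniForm-step = solve-∀
  cassini-isAlternating : IsAlternating (λ n → cassiniForm (F n) (F (suc n)))
  cassini-isAlternating n rewrite F-isFibonacciLike n = cassiniForm-step (F n) (F (suc n))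

fibonacciLike-shift : ∀ {X} → IsFibonacciLike X →
                      ∀ k n → X (n + k) ≡ X (pred k) * F n + X k * F (suc n)
fibonacciLike-shift {X} recX k = fibonacciLike-unique
  {λ n → X (n + k)} {λ n → X (pred k) * F n + X k * F (suc n)}
  (shift-isFibonacciLike {X} recX k)
  (combination-isFibonacciLike {F} {F ∘ suc}
     F-isFibonacciLike (F-isFibonacciLike ∘ suc) (X (pred k)) (X k))
  (trans (cong X (+-identityˡ k)) (at-zero (X (pred k)) (X k)))
  (begin
    X (suc k)                       ≡⟨ cong (λ i → X (suc i)) (suc-pred k) ⟨
    X (suc (suc (pred k)))          ≡⟨ recX (pred k) ⟩
    X (suc (pred k)) + X (pred k)   ≡⟨ cong (λ i → X i + X (pred k)) (suc-pred k) ⟩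
    X k + X (pred k)                ≡⟨ at-one (X (pred k)) (X k) ⟩
    X (pred k) * 1ℤ + X k * 1ℤ      ∎)
  where
  at-zero : ∀ x y → y ≡ x * 0ℤ + y * 1ℤ
  at-zero = solve-∀
  at-one : ∀ x y → y + x ≡ x * 1ℤ + y * 1ℤ
  at-one = solve-∀

L-shift : ∀ k n → L (n + k) ≡ L (pred k) * F n + L k * F (suc n)
L-shift = fibonacciLike-shift {L} L-isFibonacciLike

L≡F-combination : ∀ m → L m ≡ - + 1 * F m + + 2 * F (suc m)
L≡F-combination m = trans (cong L (sym (+-identityʳ m))) (L-shift 0ℤ m)

sumFrom-snoc : ∀ f a m → sumFrom f a (ℕ.suc m) ≡ sumFrom f a m + f (a + + m)
sumFrom-snoc f a ℕ.zero    = trans (+-comm (f a) 0ℤ) (cong (λ i → 0ℤ + f i) (sym (+-identityʳ a)))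
sumFrom-snoc f a (ℕ.suc m) = begin
  f a + sumFrom f a′ (ℕ.suc m)               ≡⟨ cong (λ s → f a + s) (sumFrom-snoc f a′ m) ⟩
  f a + (sumFrom f a′ m + f (a′ + + m))      ≡⟨ +-assoc (f a) _ _ ⟨
  f a + sumFrom f a′ m + f (a′ + + m)        ≡⟨ cong (λ i → f a + sumFrom f a′ m + f i) (+-assoc a 1ℤ (+ m)) ⟩
  f a + sumFrom f a′ m + f (a + + ℕ.suc m)   ∎
  where
  a′ = a + 1ℤ

signedSum : (ℤ → ℤ) → ℤ → ℤ → ℤ
signedSum f a (+ m)     = sumFrom f a m
signedSum f a -[1+ m ] = - sumFrom f (a + -[1+ m ]) (ℕ.suc m)

signedSum-suc : ∀ f a l → signedSum f a (suc l) ≡ signedSum f a l + f (a + l)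
signedSum-suc f a (+ m)            = sumFrom-snoc f a m
signedSum-suc f a -[1+ ℕ.zero ]  = cancel-single (f (a + -1ℤ))
  where
  cancel-single : ∀ y → 0ℤ ≡ - (y + 0ℤ) + y
  cancel-single = solve-∀
signedSum-suc f a -[1+ ℕ.suc m ] = begin
  - sumFrom f (a + -[1+ m ]) (ℕ.suc m)    ≡⟨ cong (λ i → - sumFrom f i (ℕ.suc m)) (+-assoc a _ 1ℤ) ⟨
  - sumFrom f (x + 1ℤ) (ℕ.suc m)          ≡⟨ cancel-first (f x) _ ⟩
  - (f x + sumFrom f (x + 1ℤ) (ℕ.suc m)) + f x ∎
  where
  x = a + -[1+ ℕ.suc m ]
  cancel-first : ∀ y s → - s ≡ - (y + s) + y
  cancel-first = solve-∀

Σ≡signedSum : ∀ a b f → Σ[ a ⋯ b ] f ≡ signedSum f a (b - a + 1ℤ)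
Σ≡signedSum a b f with b - a + 1ℤ in eq
... | + m      = refl
... | -[1+ m ] =
  cong (λ i → - sumFrom f i (ℕ.suc m)) (trans (b+1≡a+length a b) (cong (λ l → a + l) eq))
  where
  b+1≡a+length : ∀ a b → b + 1ℤ ≡ a + (b - a + 1ℤ)
  b+1≡a+length = solve-∀

Σ-snoc : ∀ a b f → Σ[ a ⋯ suc b ] f ≡ Σ[ a ⋯ b ] f + f (suc b)
Σ-snoc a b f = begin
  Σ[ a ⋯ suc b ] f                    ≡⟨ Σ≡signedSum a (suc b) f ⟩
  signedSum f a (suc b - a + 1ℤ)      ≡⟨ cong (signedSum f a) (length-suc a b) ⟩
  signedSum f a (suc l)               ≡⟨ signedSum-suc f a l ⟩
  signedSum f a l + f (a + l)         ≡⟨ cong₂ _+_ (Σ≡signedSum a b f) (cong f (a+length a b)) ⟨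
  Σ[ a ⋯ b ] f + f (suc b)            ∎
  where
  l = b - a + 1ℤ
  length-suc : ∀ a b → 1ℤ + b - a + 1ℤ ≡ 1ℤ + (b - a + 1ℤ)
  length-suc = solve-∀
  a+length : ∀ a b → 1ℤ + b ≡ a + (b - a + 1ℤ)
  a+length = solve-∀

startIndex-suc-suc : ∀ n → startIndex (suc (suc n)) ≡ startIndex n
startIndex-suc-suc (+ m)                    = refl
startIndex-suc-suc -[1+ 0 ]                 = refl
startIndex-suc-suc -[1+ 1 ]                 = refl
startIndex-suc-suc -[1+ ℕ.suc (ℕ.suc m) ] = refl

lucasTerm : ℤ → ℤ
lucasTerm k = neg1^ (k - + 1) * L k ^ 4

lucasSum : ℤ → ℤ
lucasSum n = Σ[ startIndex n ⋯ n ] lucasTerm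

closedForm : ℤ → ℤ
closedForm n =
  neg1^ (n - + 1) * + 5 * F n * F (n + + 1) * (L (n - + 2) * L (n + + 3) + + 2 * neg1^ n)

LucasIdentity : ℤ → Set
LucasIdentity n = + 3 * lucasSum n ≡ closedForm n

termPoly : ℤ → ℤ → ℤ
termPoly a b = - cassiniForm a b * (- + 1 * a + + 2 * b) ^ 4

closedPoly : ℤ → ℤ → ℤ
closedPoly a b =
  - cassiniForm a b * + 5 * a * b
    * ((- + 4 * a + + 3 * b) * (+ 3 * a + + 4 * b) + + 2 * cassiniForm a b)

lucasTerm≡termPoly : ∀ m → lucasTerm m ≡ termPoly (F m) (F (suc m))
lucasTerm≡termPoly m rewrite neg1^-pred m | neg1^≡cassiniForm m | L≡F-combination m = refl

closedForm≡closedPoly : ∀ m → closedForm m ≡ closedPoly (F m) (F (suc m))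
closedForm≡closedPoly m
  rewrite neg1^-pred m | neg1^≡cassiniForm m | +-comm m 1ℤ
        | L-shift (- + 2) m | L-shift (+ 3) m
        = refl

closedPoly-step : ∀ a b →
  closedPoly (b + a) (b + a + b)
    ≡ closedPoly a b + + 3 * (termPoly b (b + a) + termPoly (b + a) (b + a + b))
closedPoly-step = polynomial-identity
  where
  -- The solver neither unfolds definitions nor handles _^_, hence the inlined copy.
  polynomial-identity : ∀ a b →
    let cas    = λ u v → v * v - v * u - u * u
        pow₄   = λ x → x * (x * (x * (x * 1ℤ)))
        term   = λ u v → - cas u v * pow₄ (- + 1 * u + + 2 * v)
        closed = λ u v → - cas u v * + 5 * u * v
                           * ((- + 4 * u + + 3 * v) * (+ 3 * u + + 4 * v) + + 2 * cas u v)
    in closed (b + a) (b + a + b) ≡ closed a b + + 3 * (term b (b + a) + term (b + a) (b + a + b))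
  polynomial-identity = solve-∀

lucasSum-suc-suc : ∀ n →
  lucasSum (suc (suc n)) ≡ lucasSum n + (lucasTerm (suc n) + lucasTerm (suc (suc n)))
lucasSum-suc-suc n = begin
  Σ[ startIndex (suc (suc n)) ⋯ suc (suc n) ] lucasTerm
    ≡⟨ cong (λ a → Σ[ a ⋯ suc (suc n) ] lucasTerm) (startIndex-suc-suc n) ⟩
  Σ[ a ⋯ suc (suc n) ] lucasTerm                              ≡⟨ Σ-snoc a (suc n) lucasTerm ⟩
  Σ[ a ⋯ suc n ] lucasTerm + lucasTerm (suc (suc n))
    ≡⟨ cong (_+ lucasTerm (suc (suc n))) (Σ-snoc a n lucasTerm) ⟩
  lucasSum n + lucasTerm (suc n) + lucasTerm (suc (suc n))    ≡⟨ +-assoc (lucasSum n) _ _ ⟩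
  lucasSum n + (lucasTerm (suc n) + lucasTerm (suc (suc n)))  ∎
  where
  a = startIndex n

closedForm-suc-suc : ∀ n →
  closedForm (suc (suc n)) ≡ closedForm n + + 3 * (lucasTerm (suc n) + lucasTerm (suc (suc n)))
closedForm-suc-suc n = begin
  closedForm (suc (suc n))                                ≡⟨ closedForm≡closedPoly (suc (suc n)) ⟩
  closedPoly (F (suc (suc n))) (F (suc (suc (suc n))))    ≡⟨ cong₂ closedPoly F₂ F₃ ⟩
  closedPoly (b + a) (b + a + b)                          ≡⟨ closedPoly-step a b ⟩
  closedPoly a b + + 3 * (termPoly b (b + a) + termPoly (b + a) (b + a + b))
    ≡⟨ cong₂ (λ x y → x + + 3 * y) (closedForm≡closedPoly n) (cong₂ _+_ term₁ term₂) ⟨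
  closedForm n + + 3 * (lucasTerm (suc n) + lucasTerm (suc (suc n)))  ∎
  where
  a = F n
  b = F (suc n)
  F₂ : F (suc (suc n)) ≡ b + a
  F₂ = F-isFibonacciLike n
  F₃ : F (suc (suc (suc n))) ≡ b + a + b
  F₃ = trans (F-isFibonacciLike (suc n)) (cong (_+ b) F₂)
  term₁ : lucasTerm (suc n) ≡ termPoly b (b + a)
  term₁ = trans (lucasTerm≡termPoly (suc n)) (cong (termPoly b) F₂)
  term₂ : lucasTerm (suc (suc n)) ≡ termPoly (b + a) (b + a + b)
  term₂ = trans (lucasTerm≡termPoly (suc (suc n))) (cong₂ termPoly F₂ F₃)

lucasIdentity-suc-suc : ∀ n → LucasIdentity n ⇔ LucasIdentity (suc (suc n))
lucasIdentity-suc-suc n = mk⇔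
  (λ p → trans sum-step (trans (cong (_+ + 3 * g) p) (sym (closedForm-suc-suc n))))
  (λ q → ∙-cancelʳ (+ 3 * g) _ _ (trans (sym sum-step) (trans q (closedForm-suc-suc n))))
  where
  g = lucasTerm (suc n) + lucasTerm (suc (suc n))
  sum-step : + 3 * lucasSum (suc (suc n)) ≡ + 3 * lucasSum n + + 3 * g
  sum-step = trans (cong (+ 3 *_) (lucasSum-suc-suc n)) (*-distribˡ-+ (+ 3) (lucasSum n) g)

mainTheorem10 : (n : ℤ) →
    + 3 * Σ[ startIndex n ⋯ n ] (λ k → neg1^ (k - + 1) * L k ^ 4)
      ≡ neg1^ (n - + 1) * + 5 * F n * F (n + + 1)
          * (L (n - + 2) * L (n + + 3) + + 2 * neg1^ n)
mainTheorem10 = ℤ-induction₂ LucasIdentity lucasIdentity-suc-suc refl refl
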